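{- Let $X$ be a finite poset and $k$ a commutative ring. Then $\mathrm{Int}^{0}_k(X)$ is the category whose objects are the intervals of $X$ and whose morphisms are $\mathrm{Hom}_{\mathrm{Int}^{0}_k(X)}([a,b],[c,d])\cong k$ if $a\leqslant c\leqslant b\leqslant d$, and $0$ otherwise, with composition given by scalar multiplication.
   Context: For a poset $(P,\leqslant)$, $\mathcal{C}_P$ is the category with objects the elements of $P$ and exactly one morphism $p\to p'$ if $p\leqslant p'$, none otherwise; $k\mathcal{C}_P$ is its $k$-linearization, and $\mathcal{F}_{P,k}$ is the category of $k$-linear functors $k\mathcal{C}_P\to k\text{ -Mod}$. An interval of $X$ is a set $[a,b]=\{z\in X: a\leqslant z\leqslant b\}$ with $a\leqslant b$. For such an interval, $M_{a,b}\in\mathcal{F}_{X,k}$ is the functor with $M_{a,b}(x)=k$ if $a\leqslant x\leqslant b$ and $0$ otherwise, sending the morphism $x\to y$ ($x\leqslant y$) to $\mathrm{id}_k$ if $a\leqslant x\leqslant y\leqslant b$ and to $0$ otherwise. The category $\mathrm{Int}^{0}_k(X)$ has the intervals of $X$ as objects and $\mathrm{Hom}_{\mathrm{Int}^{0}_k(X)}([c,d],[a,b]):=\mathrm{Hom}_{\mathcal{F}_{X,k}}(M_{a,b},M_{c,d})$, with composition induced (in the opposite order) by composition of natural transformations. "Composition given by scalar multiplication" means that the composite of the basis elements of two nonzero Hom-spaces is the basis element of the composite Hom-space when that space is nonzero, and $0$ otherwise. -}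

module Defs where

open import Level using (Level; _⊔_; suc; 0ℓ)
open import Data.Nat using (ℕ)
open import Data.Fin using (Fin)
open import Data.Product using (_×_; _,_)
open import Data.Product.Relation.Unary.All using ()
open import Relation.Nullary using (Dec; yes; no; ¬_)
open import Relation.Nullary.Decidable using (_×-dec_)
open import Relation.Binary.Core using (Rel)
open import Relation.Binary.Definitions using (Irrelevant)
open import Relation.Binary.Structures using (IsDecPartialOrder)
open import Relation.Binary.PropositionalEquality using (_≡_)
open import Data.Empty using (⊥-elim)
open import Algebra.Bundles using (CommutativeRing)
open import Algebra.Module.Bundles using (Module)
import Algebra.Module.Construct.TensorUnit as TU
import Algebra.Module.Construct.Zero as Z

-- A finite poset is represented on the carrier Fin n,
-- with a decidable partial order (decidability of the order is automatic
-- for a finite poset classically; constructively we include it) whose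
-- relation is proof-irrelevant (a poset's order is a relation: the
-- category C_P has AT MOST ONE morphism p → p').

record FinPoset : Set₁ where
  field
    size              : ℕ
    _≤_               : Rel (Fin size) 0ℓ
    isDecPartialOrder : IsDecPartialOrder _≡_ _≤_
    ≤-irrelevant      : Irrelevant _≤_

  open IsDecPartialOrder isDecPartialOrder public
    using (_≤?_) renaming (refl to ≤-refl; trans to ≤-trans)

  Elt : Set
  Elt = Fin size

module _ {c ℓ : Level} {k : CommutativeRing c ℓ} where

  record LinMap {m₁ ℓ₁ m₂ ℓ₂ : Level} (M : Module k m₁ ℓ₁) (N : Module k m₂ ℓ₂)
         : Set (c ⊔ m₁ ⊔ ℓ₁ ⊔ m₂ ⊔ ℓ₂) where
    private
      module M = Module M
      module N = Module N
    field
      fun   : M.Carrierᴹ → N.Carrierᴹ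
      cong  : ∀ {u v} → u M.≈ᴹ v → fun u N.≈ᴹ fun v
      +-hom : ∀ u v → fun (u M.+ᴹ v) N.≈ᴹ (fun u N.+ᴹ fun v)
      *-hom : ∀ (r : CommutativeRing.Carrier k) u → fun (r M.*ₗ u) N.≈ᴹ (r N.*ₗ fun u)

  open LinMap public

  idLin : ∀ {m ℓm} (M : Module k m ℓm) → LinMap M M
  idLin M = record
    { fun = λ u → u ; cong = λ p → p
    ; +-hom = λ _ _ → Module.≈ᴹ-refl M ; *-hom = λ _ _ → Module.≈ᴹ-refl M }

  zeroLin : ∀ {m₁ ℓ₁ m₂ ℓ₂} (M : Module k m₁ ℓ₁) (N : Module k m₂ ℓ₂) → LinMap M N
  zeroLin M N = record
    { fun = λ _ → N.0ᴹ ; cong = λ _ → N.≈ᴹ-refl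
    ; +-hom = λ _ _ → N.≈ᴹ-sym (N.+ᴹ-identityˡ N.0ᴹ)
    ; *-hom = λ r _ → N.≈ᴹ-sym (N.*ₗ-zeroʳ r) }
    where module N = Module N

-- A k-linear functor out of the k-linearisation kC_X is the same as a
-- functor C_X → k-Mod: modules F₀ x, linear maps F₁ (x ≤ y), functorial.
-- (Modules are taken at the universe levels of k.)

module Int0 {c ℓ : Level} (k : CommutativeRing c ℓ) (X : FinPoset) where

  open FinPoset X
  open CommutativeRing k using (Carrier) renaming (_≈_ to _≈k_; _*_ to _*k_)

  Mod : Set (suc (c ⊔ ℓ))
  Mod = Module k c ℓ

  record Functor : Set (suc (c ⊔ ℓ)) where
    field
      F₀   : Elt → Mod
      F₁   : ∀ {x y} → x ≤ y → LinMap (F₀ x) (F₀ y)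
      F-id : ∀ {x} (u : Module.Carrierᴹ (F₀ x)) →
             Module._≈ᴹ_ (F₀ x) (fun (F₁ (≤-refl {x})) u) u
      F-∘  : ∀ {x y z} (p : x ≤ y) (q : y ≤ z) (u : Module.Carrierᴹ (F₀ x)) →
             Module._≈ᴹ_ (F₀ z) (fun (F₁ (≤-trans p q)) u) (fun (F₁ q) (fun (F₁ p) u))

  open Functor public

  record NatTrans (F G : Functor) : Set (c ⊔ ℓ) where
    field
      η       : ∀ x → LinMap (F₀ F x) (F₀ G x)
      natural : ∀ {x y} (p : x ≤ y) (u : Module.Carrierᴹ (F₀ F x)) →
                Module._≈ᴹ_ (F₀ G y) (fun (η y) (fun (F₁ F p) u)) (fun (F₁ G p) (fun (η x) u))

  open NatTrans public

  _≈N_ : ∀ {F G} → NatTrans F G → NatTrans F G → Set (c ⊔ ℓ)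
  _≈N_ {F} {G} α β = ∀ x (u : Module.Carrierᴹ (F₀ F x)) →
    Module._≈ᴹ_ (F₀ G x) (fun (η α x) u) (fun (η β x) u)

  0N : ∀ {F G} → NatTrans F G
  0N {F} {G} = record
    { η = λ x → zeroLin (F₀ F x) (F₀ G x)
    ; natural = λ {x} {y} p u → Module.≈ᴹ-sym (F₀ G y) (Z0.0-hom′ (F₁ G p)) }
    where
      module Z0 {x y} (f : LinMap (F₀ G x) (F₀ G y)) where
        module N = Module (F₀ G x)
        module N′ = Module (F₀ G y)
        0-hom′ : fun f N.0ᴹ N′.≈ᴹ N′.0ᴹ
        0-hom′ = N′.≈ᴹ-trans (cong f (N.≈ᴹ-sym (N.*ₗ-zeroˡ N.0ᴹ)))
                  (N′.≈ᴹ-trans (*-hom f _ N.0ᴹ) (N′.*ₗ-zeroˡ _))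

  _·N_ : ∀ {F G} → Carrier → NatTrans F G → NatTrans F G
  _·N_ {F} {G} r α = record
    { η = λ x → record
        { fun = λ u → Module._*ₗ_ (F₀ G x) r (fun (η α x) u)
        ; cong = λ p → Module.*ₗ-congˡ (F₀ G x) (cong (η α x) p)
        ; +-hom = λ u v → let module N = Module (F₀ G x) in
            N.≈ᴹ-trans (N.*ₗ-congˡ (+-hom (η α x) u v)) (N.*ₗ-distribˡ r _ _)
        ; *-hom = λ s u → let module N = Module (F₀ G x) in
            N.≈ᴹ-trans (N.*ₗ-congˡ (*-hom (η α x) s u))
              (N.≈ᴹ-trans (N.≈ᴹ-sym (N.*ₗ-assoc r s _))
                (N.≈ᴹ-trans (N.*ₗ-congʳ (CommutativeRing.*-comm k r s)) (N.*ₗ-assoc s r _))) }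
    ; natural = λ {x} {y} p u → let module N = Module (F₀ G y) in
        N.≈ᴹ-trans (N.*ₗ-congˡ (natural α p u)) (N.≈ᴹ-sym (*-hom (F₁ G p) r _)) }

  _∘N_ : ∀ {F G H} → NatTrans G H → NatTrans F G → NatTrans F H
  _∘N_ {F} {G} {H} β α = record
    { η = λ x → record
        { fun = λ u → fun (η β x) (fun (η α x) u)
        ; cong = λ p → cong (η β x) (cong (η α x) p)
        ; +-hom = λ u v → Module.≈ᴹ-trans (F₀ H x)
            (cong (η β x) (+-hom (η α x) u v)) (+-hom (η β x) _ _)
        ; *-hom = λ r u → Module.≈ᴹ-trans (F₀ H x)
            (cong (η β x) (*-hom (η α x) r u)) (*-hom (η β x) r _) }
    ; natural = λ {x} {y} p u → Module.≈ᴹ-trans (F₀ H y)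
        (cong (η β y) (natural α p u)) (natural β p (fun (η α x) u)) }

  record Interval : Set where
    constructor [_,_]⟨_⟩
    field
      lo    : Elt
      hi    : Elt
      lo≤hi : lo ≤ hi

  open Interval public

  ModOf : ∀ {A : Set} → Dec A → Mod
  ModOf (yes _) = TU.⟨module⟩ {R = k}
  ModOf (no _)  = Z.⟨module⟩ {c} {ℓ} {R = k}

  mapOf : ∀ {A B : Set} (d : Dec A) (e : Dec B) → LinMap (ModOf d) (ModOf e)
  mapOf (yes _) (yes _) = idLin _
  mapOf (yes _) (no _)  = zeroLin _ _
  mapOf (no _)  e       = zeroLin _ _

  module _ (a b : Elt) where

    inI? : ∀ x → Dec (a ≤ x × x ≤ b)
    inI? x = (a ≤? x) ×-dec (x ≤? b)

    private
      mid : ∀ {x y z} → a ≤ x × x ≤ b → x ≤ y → y ≤ z → a ≤ z × z ≤ b → a ≤ y × y ≤ b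
      mid (ax , _) p q (_ , zb) = ≤-trans ax p , ≤-trans q zb

      Mid-id : ∀ x (u : Module.Carrierᴹ (ModOf (inI? x))) →
               Module._≈ᴹ_ (ModOf (inI? x)) (fun (mapOf (inI? x) (inI? x)) u) u
      Mid-id x u with inI? x
      ... | yes _ = CommutativeRing.refl k
      ... | no _  = _

      Mid-∘ : ∀ {x y z} (p : x ≤ y) (q : y ≤ z) (u : Module.Carrierᴹ (ModOf (inI? x))) →
              Module._≈ᴹ_ (ModOf (inI? z)) (fun (mapOf (inI? x) (inI? z)) u)
                (fun (mapOf (inI? y) (inI? z)) (fun (mapOf (inI? x) (inI? y)) u))
      Mid-∘ {x} {y} {z} p q u with inI? x | inI? y | inI? z
      ... | yes _  | yes _ | yes _  = CommutativeRing.refl k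
      ... | yes hx | no ny | yes hz = ⊥-elim (ny (mid hx p q hz))
      ... | yes _  | yes _ | no _   = _
      ... | yes _  | no _  | no _   = _
      ... | no _   | yes _ | yes _  = CommutativeRing.refl k
      ... | no _   | no _  | yes _  = CommutativeRing.refl k
      ... | no _   | _     | no _   = _

    M : Functor
    M = record
      { F₀   = λ x → ModOf (inI? x)
      ; F₁   = λ {x} {y} _ → mapOf (inI? x) (inI? y)
      ; F-id = λ {x} u → Mid-id x u
      ; F-∘  = Mid-∘ }

  M[_] : Interval → Functor
  M[ I ] = M (lo I) (hi I)

  -- The category Int⁰_k(X):
  --   Hom_{Int⁰}([c,d],[a,b]) := Hom_{F_{X,k}}(M_{a,b}, M_{c,d}),
  -- i.e. Hom_{Int⁰}(I , J) = Hom_F(M_J , M_I).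

  -- (wrapped in a record so that I and J are inferable)
  record Hom (I J : Interval) : Set (c ⊔ ℓ) where
    constructor hom
    field
      nat : NatTrans M[ J ] M[ I ]

  open Hom public

  _≈H_ : ∀ {I J} → Hom I J → Hom I J → Set (c ⊔ ℓ)
  f ≈H g = nat f ≈N nat g

  _·H_ : ∀ {I J} → Carrier → Hom I J → Hom I J
  r ·H f = hom (r ·N nat f)

  0H : ∀ {I J} → Hom I J
  0H = hom 0N

  _∘H_ : ∀ {I J K} → Hom J K → Hom I J → Hom I K
  g ∘H f = hom (nat f ∘N nat g)

  Cond : Interval → Interval → Set
  Cond I J = lo I ≤ lo J × lo J ≤ hi I × hi I ≤ hi J

-- A morphism [a,b] → [c,d] is a natural transformation α : M_{c,d} → M_{a,b}.
-- Naturality along c ≤ x shows that every component of α is r times the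
-- canonical map (identity where both modules are k, zero elsewhere), where
-- r = α_c(1) if c ∈ [a,b] and r = 0 otherwise.  Naturality along c ≤ b forces
-- r = 0 unless a ≤ c ≤ b ≤ d, and under that condition the canonical maps are
-- natural and compose to the canonical map.
module Submission where

open import Defs
open import Level using (Level)
open import Data.Product using (Σ; _×_; _,_)
open import Relation.Nullary using (¬_; Dec; yes; no)
open import Data.Empty using (⊥-elim)
open import Algebra.Bundles using (CommutativeRing)
open import Algebra.Module.Bundles using (Module)
import Algebra.Module.Construct.TensorUnit as TensorUnit

module _ {c ℓ : Level} {k : CommutativeRing c ℓ} where

  open CommutativeRing k

  fun-0ᴹ : ∀ {m₁ ℓ₁ m₂ ℓ₂} {M : Module k m₁ ℓ₁} {N : Module k m₂ ℓ₂} (g : LinMap M N) →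
           Module._≈ᴹ_ N (fun g (Module.0ᴹ M)) (Module.0ᴹ N)
  fun-0ᴹ {M = M} {N} g =
    N.≈ᴹ-trans (cong g (M.≈ᴹ-sym (M.*ₗ-zeroˡ M.0ᴹ))) (N.≈ᴹ-trans (*-hom g _ M.0ᴹ) (N.*ₗ-zeroˡ _))
    where
      module M = Module M
      module N = Module N

  fun≈fun1#* : (g : LinMap (TensorUnit.⟨module⟩ {R = k}) TensorUnit.⟨module⟩) →
               ∀ u → fun g u ≈ fun g 1# * u
  fun≈fun1#* g u = trans (cong g (sym (*-identityʳ u))) (trans (*-hom g u 1#) (*-comm u _))

module IntervalMorphisms {c ℓ : Level} (X : FinPoset) (k : CommutativeRing c ℓ) where

  open FinPoset X
  open Int0 k X
  open CommutativeRing k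

  Eqᴹ : ∀ {A : Set} (d : Dec A) → Module.Carrierᴹ (ModOf d) → Module.Carrierᴹ (ModOf d) → Set ℓ
  Eqᴹ d = Module._≈ᴹ_ (ModOf d)

  Scaleᴹ : ∀ {A : Set} (d : Dec A) → Carrier → Module.Carrierᴹ (ModOf d) → Module.Carrierᴹ (ModOf d)
  Scaleᴹ d = Module._*ₗ_ (ModOf d)

  syntax Eqᴹ d u v = u ≈[ d ] v
  syntax Scaleᴹ d r u = r ·[ d ] u

  infix 4 Eqᴹ
  infixr 7 Scaleᴹ

  coefficient : ∀ {A B : Set} (d : Dec A) (e : Dec B) → LinMap (ModOf d) (ModOf e) → Carrier
  coefficient (yes _) (yes _) g = fun g 1#
  coefficient _       _       _ = 0#

  mapOf-∘ : ∀ {A B C : Set} (d : Dec A) (e : Dec B) (f : Dec C) → (A → C → B) →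
            ∀ u → fun (mapOf e f) (fun (mapOf d e) u) ≈[ f ] fun (mapOf d f) u
  mapOf-∘ _       _       (no _)  _       _ = _
  mapOf-∘ (yes _) (yes _) (yes _) _       _ = refl
  mapOf-∘ (yes a) (no ¬b) (yes γ) between _ = ⊥-elim (¬b (between a γ))
  mapOf-∘ (no _)  (yes _) (yes _) _       _ = refl
  mapOf-∘ (no _)  (no _)  (yes _) _       _ = refl

  mapOf-square : ∀ {A B C D : Set} (d₁ : Dec A) (d₂ : Dec B) (e₁ : Dec C) (e₂ : Dec D) →
                 (A → D → B) → (A → D → C) →
                 ∀ u → fun (mapOf d₂ e₂) (fun (mapOf d₁ d₂) u) ≈[ e₂ ] fun (mapOf e₁ e₂) (fun (mapOf d₁ e₁) u)
  mapOf-square d₁ d₂ e₁ e₂ viaB viaC u = Module.≈ᴹ-trans (ModOf e₂)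
    (mapOf-∘ d₁ d₂ e₂ viaB u) (Module.≈ᴹ-sym (ModOf e₂) (mapOf-∘ d₁ e₁ e₂ viaC u))

  ·mapOf-injective : ∀ {A B : Set} (d : Dec A) (e : Dec B) → A → B → ∀ r s →
                     (∀ u → r ·[ e ] fun (mapOf d e) u ≈[ e ] s ·[ e ] fun (mapOf d e) u) → r ≈ s
  ·mapOf-injective (no ¬a) _       a _ _ _ _ = ⊥-elim (¬a a)
  ·mapOf-injective (yes _) (no ¬b) _ b _ _ _ = ⊥-elim (¬b b)
  ·mapOf-injective (yes _) (yes _) _ _ r s r≈s =
    trans (sym (*-identityʳ r)) (trans (r≈s 1#) (*-identityʳ s))

  -- For a morphism [a,b] → [c,d], the decisions jc, ic, jx, ix below are the
  -- memberships c ∈ [c,d], c ∈ [a,b], x ∈ [c,d], x ∈ [a,b], and the last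
  -- hypothesis is naturality along c ≤ x (available when x ∈ [c,d]).
  fun≈coefficient·mapOf :
    ∀ {A B C D : Set} (jc : Dec A) (ic : Dec B) (jx : Dec C) (ix : Dec D) → A →
    (ηc : LinMap (ModOf jc) (ModOf ic)) (ηx : LinMap (ModOf jx) (ModOf ix)) →
    (C → ∀ u → fun ηx (fun (mapOf jc jx) u) ≈[ ix ] fun (mapOf ic ix) (fun ηc u)) →
    ∀ u → fun ηx u ≈[ ix ] coefficient jc ic ηc ·[ ix ] fun (mapOf jx ix) u
  fun≈coefficient·mapOf (no ¬a) _       _         _       a _  _  _       _ = ⊥-elim (¬a a)
  fun≈coefficient·mapOf (yes _) _       _         (no _)  _ _  _  _       _ = _
  fun≈coefficient·mapOf (yes _) _       (no _)    (yes _) _ _  ηx _       _ =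
    trans (fun-0ᴹ ηx) (sym (zeroʳ _))
  fun≈coefficient·mapOf (yes _) (yes _) (yes x∈J) (yes _) _ ηc _  natural u =
    trans (natural x∈J u) (fun≈fun1#* ηc u)
  fun≈coefficient·mapOf (yes _) (no _)  (yes x∈J) (yes _) _ _  _  natural u =
    trans (natural x∈J u) (sym (zeroˡ u))

  -- Same encoding, with b in place of x: if c ∈ [a,b] but b ∉ [c,d], then
  -- naturality along c ≤ b sends 1 to the value of α_b at 0.
  coefficient≈0 :
    ∀ {A B C D : Set} (jc : Dec A) (ic : Dec B) (jb : Dec C) (ib : Dec D) → A → (B → ¬ C) → D →
    (ηc : LinMap (ModOf jc) (ModOf ic)) (ηb : LinMap (ModOf jb) (ModOf ib)) →
    (B → ∀ u → fun ηb (fun (mapOf jc jb) u) ≈[ ib ] fun (mapOf ic ib) (fun ηc u)) →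
    coefficient jc ic ηc ≈ 0#
  coefficient≈0 (no ¬a) _         _       _        a _      _ _ _  _       = ⊥-elim (¬a a)
  coefficient≈0 (yes _) (no _)    _       _        _ _      _ _ _  _       = refl
  coefficient≈0 (yes _) (yes c∈I) (yes b∈J) _      _ b∉J    _ _ _  _       = ⊥-elim (b∉J c∈I b∈J)
  coefficient≈0 (yes _) (yes _)   (no _)  (no ¬d)  _ _      d _ _  _       = ⊥-elim (¬d d)
  coefficient≈0 (yes _) (yes c∈I) (no _)  (yes _)  _ _      _ _ ηb natural =
    trans (sym (natural c∈I 1#)) (fun-0ᴹ ηb)

  _∋?_ : (I : Interval) (x : Elt) → Dec (lo I ≤ x × x ≤ hi I)
  I ∋? x = inI? (lo I) (hi I) x

  scalar : ∀ {I J} → Hom I J → Carrier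
  scalar {I} {J} f = coefficient (J ∋? lo J) (I ∋? lo J) (η (nat f) (lo J))

  component≈scalar·mapOf : ∀ {I J} (f : Hom I J) x u →
    fun (η (nat f) x) u ≈[ I ∋? x ] scalar f ·[ I ∋? x ] fun (mapOf (J ∋? x) (I ∋? x)) u
  component≈scalar·mapOf {I} {J} f x = fun≈coefficient·mapOf
    (J ∋? lo J) (I ∋? lo J) (J ∋? x) (I ∋? x) (≤-refl , lo≤hi J)
    (η (nat f) (lo J)) (η (nat f) x) (λ (c≤x , _) → natural (nat f) c≤x)

  scalar≈0 : ∀ {I J} → ¬ Cond I J → (f : Hom I J) → scalar f ≈ 0#
  scalar≈0 {I} {J} ¬cond f = coefficient≈0
    (J ∋? lo J) (I ∋? lo J) (J ∋? hi I) (I ∋? hi I) (≤-refl , lo≤hi J)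
    (λ (a≤c , c≤b) (_ , b≤d) → ¬cond (a≤c , c≤b , b≤d)) (lo≤hi I , ≤-refl)
    (η (nat f) (lo J)) (η (nat f) (hi I)) (λ (_ , c≤b) → natural (nat f) c≤b)

  ≈0H : ∀ I J → ¬ Cond I J → (f : Hom I J) → f ≈H 0H
  ≈0H I _ ¬cond f x u = Iₓ.≈ᴹ-trans (component≈scalar·mapOf f x u)
    (Iₓ.≈ᴹ-trans (Iₓ.*ₗ-congʳ (scalar≈0 ¬cond f)) (Iₓ.*ₗ-zeroˡ _))
    where module Iₓ = Module (ModOf (I ∋? x))

  -- The canonical morphism: identity on [a,b] ∩ [c,d] = [c,b], zero elsewhere.
  basis : ∀ I J → Cond I J → Hom I J
  basis I J (a≤c , _ , b≤d) = hom record
    { η       = λ x → mapOf (J ∋? x) (I ∋? x)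
    ; natural = λ {x} {y} x≤y → mapOf-square (J ∋? x) (J ∋? y) (I ∋? x) (I ∋? y)
        (λ (c≤x , _) (_ , y≤b) → ≤-trans c≤x x≤y , ≤-trans y≤b b≤d)
        (λ (c≤x , _) (_ , y≤b) → ≤-trans a≤c c≤x , ≤-trans x≤y y≤b) }

  ≈scalar·basis : ∀ {I J} (h : Cond I J) (f : Hom I J) → f ≈H (scalar f ·H basis I J h)
  ≈scalar·basis _ = component≈scalar·mapOf

  ·basis-injective : ∀ I J (h : Cond I J) r s → (r ·H basis I J h) ≈H (s ·H basis I J h) → r ≈ s
  ·basis-injective I J (a≤c , c≤b , _) r s r≈s =
    ·mapOf-injective (J ∋? lo J) (I ∋? lo J) (≤-refl , lo≤hi J) (a≤c , c≤b) r s (r≈s (lo J))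

  basis-∘ : ∀ I J K (h₁ : Cond I J) (h₂ : Cond J K) (h₃ : Cond I K) →
            (basis J K h₂ ∘H basis I J h₁) ≈H basis I K h₃
  basis-∘ I J K (_ , _ , b≤d) (c≤e , _ , _) _ x = mapOf-∘ (K ∋? x) (J ∋? x) (I ∋? x)
    (λ (e≤x , _) (_ , x≤b) → ≤-trans c≤e e≤x , ≤-trans x≤b b≤d)

corollary2p5 : {c ℓ : Level} (X : FinPoset) (k : CommutativeRing c ℓ) →
    let open Int0 k X in Σ (∀ I J → Cond I J → Hom I J) λ e →
         (∀ I J (h : Cond I J) →
            (∀ (f : Hom I J) → Σ (CommutativeRing.Carrier k) λ r → f ≈H (r ·H e I J h))
            × (∀ r s → (r ·H e I J h) ≈H (s ·H e I J h) → CommutativeRing._≈_ k r s))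
         × (∀ I J → ¬ Cond I J → ∀ (f : Hom I J) → f ≈H 0H)
         × (∀ I J K (h₁ : Cond I J) (h₂ : Cond J K) →
              ((h₃ : Cond I K) → (e J K h₂ ∘H e I J h₁) ≈H e I K h₃)
              × (¬ Cond I K → (e J K h₂ ∘H e I J h₁) ≈H 0H))
corollary2p5 X k =
    basis
  , (λ I J h → (λ f → scalar f , ≈scalar·basis h f) , ·basis-injective I J h)
  , ≈0H
  , λ I J K h₁ h₂ → basis-∘ I J K h₁ h₂ , λ ¬h₃ → ≈0H I K ¬h₃ (basis J K h₂ ∘H basis I J h₁)
  where
    open Int0 k X using (_∘H_)
    open IntervalMorphisms X k
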